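{- Let $m \geq 2$ be an integer. Then $g(m,2) = 5m-4$.
   Context: For positive integers $m$ and $r$, $g(m,r)$ denotes the least positive integer $N$ such that for every map $\Delta:\{1,2,\ldots,N\}\to\{1,2,\ldots,r\}$ there exist $2m$ integers $x_1<\cdots<x_m<y_1<\cdots<y_m$ in $\{1,\ldots,N\}$ with $\Delta(x_1)=\cdots=\Delta(x_m)$, $\Delta(y_1)=\cdots=\Delta(y_m)$, and $2(x_m-x_1)\leq y_m-x_1$. -}

module Defs where

open import Data.Nat using (ℕ; zero; suc; _+_; _*_; _∸_; _≤_; _<_)
open import Data.Fin using (Fin)
open import Relation.Binary.PropositionalEquality using (_≡_)
open import Data.Product using (Σ; _×_; ∃-syntax)

-- We use maps ℕ → Fin r; only the
-- values on {1,…,N} are ever inspected, and every map {1..N} → {1..r}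
-- extends to such a map, so quantifying over these is equivalent.
Colouring : ℕ → Set
Colouring r = ℕ → Fin r

-- Sequences x_1,…,x_m are represented by functions x : ℕ → ℕ, where
-- x i (for i < m) is x_{i+1}; values at indices ≥ m are irrelevant.
-- Thus x 0 = x_1 and x (m ∸ 1) = x_m.

HasConfig : (m r N : ℕ) → Colouring r → Set
HasConfig m r N Δ =
  Σ (ℕ → ℕ) λ x → Σ (ℕ → ℕ) λ y →
    ((i : ℕ) → i < m → 1 ≤ x i × x i ≤ N × 1 ≤ y i × y i ≤ N)
    × ((i : ℕ) → suc i < m → x i < x (suc i) × y i < y (suc i))
    × (x (m ∸ 1) < y 0)
    × ((i : ℕ) → i < m → Δ (x i) ≡ Δ (x 0))
    × ((i : ℕ) → i < m → Δ (y i) ≡ Δ (y 0))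
    × (2 * (x (m ∸ 1) ∸ x 0) ≤ y (m ∸ 1) ∸ x 0)

Arrows : (m r N : ℕ) → Set
Arrows m r N = (Δ : Colouring r) → HasConfig m r N Δ

IsG : (m r n : ℕ) → Set
IsG m r n = 1 ≤ n × Arrows m r n × ((N : ℕ) → 1 ≤ N → Arrows m r N → n ≤ N)

-- Write j = m − 1.  Upper bound, N = 5j + 1: some colour occurs m times among the 2j + 1
-- points [1, 2j + 1], giving x.  Let c be the colour of N.  Either c occurs j times in
-- [2j + 2, 5j], and y ends at N; or the opposite colour occurs at least j times in
-- [2j + 2, 4j] and at least once in [4j + 1, 5j].  Either way y_m ≥ 4j + 1 ≥ 2 x_m − x_1.
-- Lower bound, N = 5j: colour the blocks [1, j], [j + 1, 2j], [2j + 1, 4j], [4j + 1, 5j]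
-- alternately.  A run of m points does not fit into one block of j points; so a colour-1
-- run x would force y beyond 5j, while a colour-0 run x ends after 2j with
-- 2 x_m − x_1 > 4j, so that y, which cannot end in the last block, violates the gap condition.
module Submission where

open import Data.Empty using (⊥-elim)
open import Data.Fin using (Fin; zero; suc; opposite)
open import Data.Fin.Properties using () renaming (_≟_ to _≟ᶠ_)
open import Data.Nat
open import Data.Nat.Properties
open import Data.Nat.Tactic.RingSolver using (solve-∀)
open import Data.Product using (Σ; _×_; _,_; proj₁; proj₂; ∃-syntax)
open import Data.Sum using (_⊎_; inj₁; inj₂)
open import Relation.Binary.PropositionalEquality
open import Relation.Nullary using (¬_; yes; no)

open import Defs

≤-by : ∀ {a b} w → a + w ≡ b → a ≤ b
≤-by {a} w refl = m≤m+n a w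

Increasing : ℕ → (ℕ → ℕ) → Set
Increasing n x = ∀ i → suc i < n → x i < x (suc i)

Monochromatic : ∀ {r} → Colouring r → Fin r → ℕ → (ℕ → ℕ) → Set
Monochromatic Δ c n x = ∀ i → i < n → Δ (x i) ≡ c

increasing-spread : ∀ {n x} → Increasing n x → ∀ i d → i + d < n → x i + d ≤ x (i + d)
increasing-spread {x = x} inc i zero _
  rewrite +-identityʳ i | +-identityʳ (x i) = ≤-refl
increasing-spread {n} {x} inc i (suc d) i+d+1<n = begin
  x i + suc d      ≡⟨ +-suc (x i) d ⟩
  suc (x i + d)    ≤⟨ s≤s (increasing-spread inc i d (<⇒≤ 1+i+d<n)) ⟩
  suc (x (i + d))  ≤⟨ inc (i + d) 1+i+d<n ⟩
  x (suc (i + d))  ≡⟨ cong x (sym (+-suc i d)) ⟩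
  x (i + suc d)    ∎
  where
  open ≤-Reasoning
  1+i+d<n : suc (i + d) < n
  1+i+d<n = subst (_< n) (+-suc i d) i+d+1<n

increasing-mono : ∀ {n x} → Increasing n x → ∀ {i j} → i ≤ j → j < n → x i ≤ x j
increasing-mono {x = x} inc {i} i≤j j<n with m≤n⇒∃[o]m+o≡n i≤j
... | d , refl = ≤-trans (m≤m+n (x i) d) (increasing-spread inc i d j<n)

-- That is, x n ≥ x 0 + n + (b ∸ a): the run has to jump over [a, b).
increasing-jumps-gap : ∀ {n x a b} → Increasing (suc n) x →
  (∀ i → i ≤ n → a ≤ x i → b ≤ x i) → x 0 ≤ a → a ≤ x 0 + n → x 0 + n + b ≤ x n + a
increasing-jumps-gap {n} {x} {a} {b} inc skip x₀≤a a≤x₀+n with m≤n⇒∃[o]m+o≡n x₀≤a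
... | i , refl with m≤n⇒∃[o]m+o≡n (+-cancelˡ-≤ (x 0) i n a≤x₀+n)
... | d , refl = begin
  x 0 + (i + d) + b  ≡⟨ rearrange (x 0) i d b ⟩
  (b + d) + (x 0 + i)  ≤⟨ +-monoˡ-≤ (x 0 + i) (+-monoˡ-≤ d b≤xᵢ) ⟩
  (x i + d) + (x 0 + i)  ≤⟨ +-monoˡ-≤ (x 0 + i) (increasing-spread inc i d ≤-refl) ⟩
  x (i + d) + (x 0 + i)  ∎
  where
  open ≤-Reasoning
  rearrange : ∀ x₀ i d b → x₀ + (i + d) + b ≡ (b + d) + (x₀ + i)
  rearrange = solve-∀
  b≤xᵢ : b ≤ x i
  b≤xᵢ = skip i (m≤m+n i d) (increasing-spread inc 0 i (s≤s (m≤m+n i d)))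

MonoRun : ∀ {r} → Colouring r → Fin r → ℕ → (ℕ → ℕ) → Set
MonoRun Δ c n x = Increasing n x × Monochromatic Δ c n x

module _ {r : ℕ} (Δ : Colouring r) where

  count : Fin r → ℕ → ℕ → ℕ
  count c a zero = 0
  count c a (suc l) with Δ a ≟ᶠ c
  ... | yes _ = suc (count c (suc a) l)
  ... | no _  = count c (suc a) l

  count-+ : ∀ c a l l′ → count c a (l + l′) ≡ count c a l + count c (a + l) l′
  count-+ c a zero l′ = cong (λ b → count c b l′) (sym (+-identityʳ a))
  count-+ c a (suc l) l′ rewrite +-suc a l with Δ a ≟ᶠ c
  ... | yes _ = cong suc (count-+ c (suc a) l l′)
  ... | no _  = count-+ c (suc a) l l′

  record ColourRun (c : Fin r) (a l k p : ℕ) : Set where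
    field
      point      : ℕ → ℕ
      point-last : point k ≡ p
      increasing : Increasing (suc k) point
      coloured   : Monochromatic Δ c k point
      start      : a ≤ point 0
      inside     : ∀ i → i < k → point i < a + l

  open ColourRun

  ColourRun-skip : ∀ {c a l k p} → ColourRun c (suc a) l k p → ColourRun c a (suc l) k p
  ColourRun-skip {a = a} {l} R = record
    { point      = point R
    ; point-last = point-last R
    ; increasing = increasing R
    ; coloured   = coloured R
    ; start      = ≤-trans (n≤1+n a) (start R)
    ; inside     = λ i i<k → subst (point R i <_) (sym (+-suc a l)) (inside R i i<k)
    }

  ColourRun-cons : ∀ {c a l k p} → Δ a ≡ c → ColourRun c (suc a) l k p →
                   ColourRun c a (suc l) (suc k) p
  ColourRun-cons {a = a} {l} Δa≡c R = record
    { point      = x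
    ; point-last = point-last R
    ; increasing = λ { zero _ → start R ; (suc i) 1+i<k → increasing R i (≤-pred 1+i<k) }
    ; coloured   = λ { zero _ → Δa≡c ; (suc i) i<k → coloured R i (≤-pred i<k) }
    ; start      = ≤-refl
    ; inside     = λ { zero _ → subst (a <_) (sym (+-suc a l)) (s≤s (m≤m+n a l))
                     ; (suc i) i<k → subst (point R i <_) (sym (+-suc a l)) (inside R i (≤-pred i<k)) }
    }
    where
    x : ℕ → ℕ
    x zero    = a
    x (suc i) = point R i

  colourRun : ∀ c a l k p → k ≤ count c a l → a + l ≤ p → ColourRun c a l k p
  colourRun c a l zero p _ a+l≤p = record
    { point      = λ _ → p
    ; point-last = refl
    ; increasing = λ { i (s≤s ()) }
    ; coloured   = λ i ()
    ; start      = ≤-trans (m≤m+n a l) a+l≤p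
    ; inside     = λ i ()
    }
  colourRun c a (suc l) (suc k) p k≤ a+l≤p with Δ a ≟ᶠ c
  ... | yes Δa≡c = ColourRun-cons Δa≡c (colourRun c (suc a) l k p (≤-pred k≤) a+l≤p′)
    where a+l≤p′ = subst (_≤ p) (+-suc a l) a+l≤p
  ... | no _ = ColourRun-skip (colourRun c (suc a) l (suc k) p k≤ a+l≤p′)
    where a+l≤p′ = subst (_≤ p) (+-suc a l) a+l≤p

  ColourRun⇒MonoRun : ∀ {c a l k p} (R : ColourRun c a l k p) → MonoRun Δ c k (point R)
  ColourRun⇒MonoRun R = (λ i 1+i<k → increasing R i (m≤n⇒m≤1+n 1+i<k)) , coloured R

  ColourRun⇒MonoRun⁺ : ∀ {c a l k p} (R : ColourRun c a l k p) → Δ p ≡ c →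
                       MonoRun Δ c (suc k) (point R)
  ColourRun⇒MonoRun⁺ {k = k} R Δp≡c = increasing R , coloured⁺
    where
    coloured⁺ : Monochromatic Δ _ (suc k) (point R)
    coloured⁺ i i≤k with m≤n⇒m<n∨m≡n (≤-pred i≤k)
    ... | inj₁ i<k   = coloured R i i<k
    ... | inj₂ refl  = trans (cong Δ (point-last R)) Δp≡c

opposite-≢ : (c : Fin 2) → c ≢ opposite c
opposite-≢ zero ()
opposite-≢ (suc zero) ()

≢⇒≡opposite : (d c : Fin 2) → d ≢ c → d ≡ opposite c
≢⇒≡opposite zero       zero       d≢c = ⊥-elim (d≢c refl)
≢⇒≡opposite zero       (suc zero) _   = refl
≢⇒≡opposite (suc zero) zero       _   = refl
≢⇒≡opposite (suc zero) (suc zero) d≢c = ⊥-elim (d≢c refl)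

count-+-opposite : ∀ (Δ : Colouring 2) c a l → count Δ c a l + count Δ (opposite c) a l ≡ l
count-+-opposite Δ c a zero = refl
count-+-opposite Δ c a (suc l) with Δ a ≟ᶠ c | Δ a ≟ᶠ opposite c
... | yes refl | yes e = ⊥-elim (opposite-≢ (Δ a) e)
... | yes _    | no _  = cong suc (count-+-opposite Δ c (suc a) l)
... | no _     | yes _ = trans (+-suc _ _) (cong suc (count-+-opposite Δ c (suc a) l))
... | no d≢c   | no d≢c̄ = ⊥-elim (d≢c̄ (≢⇒≡opposite (Δ a) c d≢c))

count-opposite-≥ : ∀ (Δ : Colouring 2) {c a l i} → count Δ c a l ≤ i →
                   l ∸ i ≤ count Δ (opposite c) a l
count-opposite-≥ Δ {c} {a} {l} {i} few = begin
  l ∸ i                                          ≤⟨ ∸-monoʳ-≤ l few ⟩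
  l ∸ count Δ c a l                              ≡⟨ cong (_∸ count Δ c a l) (sym (count-+-opposite Δ c a l)) ⟩
  count Δ c a l + count Δ (opposite c) a l ∸ count Δ c a l  ≡⟨ m+n∸m≡n (count Δ c a l) _ ⟩
  count Δ (opposite c) a l                       ∎
  where open ≤-Reasoning

majority-colour : ∀ (Δ : Colouring 2) a j → ∃[ c ] suc j ≤ count Δ c a (suc (j + j))
majority-colour Δ a j with suc j ≤? count Δ zero a (suc (j + j))
... | yes many = zero , many
... | no few = opposite zero , subst (_≤ count Δ (opposite zero) a (suc (j + j))) (m+n∸n≡m (suc j) j)
                                 (count-opposite-≥ Δ (≤-pred (≰⇒> few)))

2*u≤w+v⇒2*[u∸v]≤w∸v : ∀ {u v w} → v ≤ u → 2 * u ≤ w + v → 2 * (u ∸ v) ≤ w ∸ v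
2*u≤w+v⇒2*[u∸v]≤w∸v {v = v} {w} v≤u le with m≤n⇒∃[o]m+o≡n v≤u
... | t , refl = subst (_≤ w ∸ v) (cong (2 *_) (sym (m+n∸m≡n v t)))
                       (m+n≤o⇒m≤o∸n (2 * t) (+-cancelʳ-≤ v _ _ (subst (_≤ w + v) (eq v t) le)))
  where
  eq : ∀ v t → 2 * (v + t) ≡ 2 * t + v + v
  eq = solve-∀

2*[u∸v]≤w∸v⇒2*u≤w+v : ∀ {u v w} → v ≤ u → v ≤ w → 2 * (u ∸ v) ≤ w ∸ v → 2 * u ≤ w + v
2*[u∸v]≤w∸v⇒2*u≤w+v {v = v} v≤u v≤w le with m≤n⇒∃[o]m+o≡n v≤u | m≤n⇒∃[o]m+o≡n v≤w
... | t , refl | s , refl rewrite m+n∸m≡n v t | m+n∸m≡n v s = begin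
  2 * (v + t)      ≡⟨ lhs v t ⟩
  2 * t + (v + v)  ≤⟨ +-monoˡ-≤ (v + v) le ⟩
  s + (v + v)      ≡⟨ rhs v s ⟩
  v + s + v        ∎
  where
  open ≤-Reasoning
  lhs : ∀ v t → 2 * (v + t) ≡ 2 * t + (v + v)
  lhs = solve-∀
  rhs : ∀ v s → s + (v + v) ≡ v + s + v
  rhs = solve-∀

-- HasConfig (suc n), with the gap condition 2 (x n ∸ x 0) ≤ y n ∸ x 0 freed of truncated subtraction.
record TwoRuns {r} (Δ : Colouring r) (n N : ℕ) : Set where
  constructor twoRuns
  field
    x y       : ℕ → ℕ
    cx cy     : Fin r
    x-run     : MonoRun Δ cx (suc n) x
    y-run     : MonoRun Δ cy (suc n) y
    x-pos     : 1 ≤ x 0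
    separated : x n < y 0
    bounded   : y n ≤ N
    gap       : 2 * x n ≤ y n + x 0

hasConfig-intro : ∀ {r n N} {Δ : Colouring r} → TwoRuns Δ n N → HasConfig (suc n) r N Δ
hasConfig-intro {n = n} {N} (twoRuns x y _ _ (incx , colx) (incy , coly) 1≤x₀ xₙ<y₀ yₙ≤N twice) =
  x , y , bounds , (λ i 1+i<n → incx i 1+i<n , incy i 1+i<n) , xₙ<y₀ ,
  (λ i i<n → trans (colx i i<n) (sym (colx 0 (s≤s z≤n)))) ,
  (λ i i<n → trans (coly i i<n) (sym (coly 0 (s≤s z≤n)))) ,
  2*u≤w+v⇒2*[u∸v]≤w∸v (increasing-mono incx z≤n ≤-refl) twice
  where
  yₙ≥y₀ : y 0 ≤ y n
  yₙ≥y₀ = increasing-mono incy z≤n ≤-refl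
  bounds : ∀ i → i < suc n → 1 ≤ x i × x i ≤ N × 1 ≤ y i × y i ≤ N
  bounds i i<n =
    ≤-trans 1≤x₀ (increasing-mono incx z≤n i<n) ,
    ≤-trans (increasing-mono incx (≤-pred i<n) ≤-refl) (≤-trans (<⇒≤ xₙ<y₀) (≤-trans yₙ≥y₀ yₙ≤N)) ,
    ≤-trans (s≤s z≤n) (≤-trans xₙ<y₀ (increasing-mono incy z≤n i<n)) ,
    ≤-trans (increasing-mono incy (≤-pred i<n) ≤-refl) yₙ≤N

hasConfig-elim : ∀ {r n N} {Δ : Colouring r} → HasConfig (suc n) r N Δ → TwoRuns Δ n N
hasConfig-elim {n = n} {Δ = Δ} (x , y , bounds , inc , xₙ<y₀ , colx , coly , twice) =
  twoRuns x y (Δ (x 0)) (Δ (y 0)) (incx , colx) (incy , coly) (proj₁ (bounds 0 (s≤s z≤n))) xₙ<y₀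
    (proj₂ (proj₂ (proj₂ (bounds n ≤-refl))))
    (2*[u∸v]≤w∸v⇒2*u≤w+v x₀≤xₙ (≤-trans x₀≤xₙ (<⇒≤ (<-≤-trans xₙ<y₀ (increasing-mono incy z≤n ≤-refl)))) twice)
  where
  incx : Increasing (suc n) x
  incx i 1+i<n = proj₁ (inc i 1+i<n)
  incy : Increasing (suc n) y
  incy i 1+i<n = proj₂ (inc i 1+i<n)
  x₀≤xₙ : x 0 ≤ x n
  x₀≤xₙ = increasing-mono incx z≤n ≤-refl

-- m = suc (suc k) and j = suc k: xEnd = 2j + 1, yStart = 2j + 2, zStart = 4j + 1, N = 5j + 1.
module UpperBound (k : ℕ) where

  xEnd yStart zStart N : ℕ
  xEnd   = suc (suc k + suc k)
  yStart = suc xEnd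
  zStart = yStart + (k + suc k)
  N      = zStart + suc k

  N≡1+5j : N ≡ suc (5 * suc k)
  N≡1+5j = expand k
    where
    expand : ∀ k → suc (suc (suc k + suc k)) + (k + suc k) + suc k ≡ suc (5 * suc k)
    expand = solve-∀

  module _ (Δ : Colouring 2) where
    open ColourRun

    early-run : ∃[ c ] Σ (ℕ → ℕ) λ x → MonoRun Δ c (suc (suc k)) x × 1 ≤ x 0 × x (suc k) < yStart
    early-run with majority-colour Δ 1 (suc k)
    ... | c , many = c , point R , ColourRun⇒MonoRun Δ R , start R , inside R (suc k) ≤-refl
      where R = colourRun Δ c 1 xEnd (suc (suc k)) yStart many ≤-refl

    late-run : ∃[ d ] Σ (ℕ → ℕ) λ y →
               MonoRun Δ d (suc (suc k)) y × yStart ≤ y 0 × zStart ≤ y (suc k) × y (suc k) ≤ N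
    late-run with suc k ≤? count Δ (Δ N) yStart (k + suc k + suc k)
    ... | yes many = Δ N , point R , ColourRun⇒MonoRun⁺ Δ R refl , start R ,
                     subst (zStart ≤_) (sym (point-last R)) (m≤m+n zStart (suc k)) ,
                     ≤-reflexive (point-last R)
      where
      R = colourRun Δ (Δ N) yStart (k + suc k + suc k) (suc k) N many
            (≤-reflexive (sym (+-assoc yStart (k + suc k) (suc k))))
    ... | no few = opposite (Δ N) , point R , ColourRun⇒MonoRun⁺ Δ R (coloured Z 0 (s≤s z≤n)) ,
                   start R , subst (zStart ≤_) (sym (point-last R)) (start Z) ,
                   subst (_≤ N) (sym (point-last R)) (<⇒≤ (inside Z 0 (s≤s z≤n)))
      where
      fewI+J : count Δ (Δ N) yStart (k + suc k) + count Δ (Δ N) zStart (suc k) ≤ k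
      fewI+J = subst (_≤ k) (count-+ Δ (Δ N) yStart (k + suc k) (suc k)) (≤-pred (≰⇒> few))
      Z = colourRun Δ (opposite (Δ N)) zStart (suc k) 1 N
            (subst (_≤ count Δ (opposite (Δ N)) zStart (suc k)) (m+n∸n≡m 1 k)
              (count-opposite-≥ Δ (≤-trans (m≤n+m _ _) fewI+J)))
            ≤-refl
      R = colourRun Δ (opposite (Δ N)) yStart (k + suc k) (suc k) (point Z 0)
            (subst (_≤ count Δ (opposite (Δ N)) yStart (k + suc k)) (m+n∸m≡n k (suc k))
              (count-opposite-≥ Δ (≤-trans (m≤m+n _ _) fewI+J)))
            (start Z)

  config : Arrows (suc (suc k)) 2 N
  config Δ with early-run Δ | late-run Δ
  ... | cx , x , xRun , 1≤x₀ , xₘ<yStart | cy , y , yRun , yStart≤y₀ , zStart≤yₘ , yₘ≤N =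
    hasConfig-intro {Δ = Δ} (twoRuns x y cx cy xRun yRun 1≤x₀ (<-≤-trans xₘ<yStart yStart≤y₀) yₘ≤N (begin
      2 * x (suc k)  ≤⟨ *-monoʳ-≤ 2 (≤-pred xₘ<yStart) ⟩
      2 * xEnd       ≡⟨ twice-xEnd k ⟩
      zStart + 1     ≤⟨ +-mono-≤ zStart≤yₘ 1≤x₀ ⟩
      y (suc k) + x 0 ∎))
    where
    open ≤-Reasoning
    twice-xEnd : ∀ k → 2 * suc (suc k + suc k) ≡ suc (suc (suc k + suc k)) + (k + suc k) + 1
    twice-xEnd = solve-∀

  arrows : Arrows (suc (suc k)) 2 (suc (5 * suc k))
  arrows = subst (Arrows (suc (suc k)) 2) N≡1+5j config

module LowerBound (j : ℕ) where

  blockColouring : Colouring 2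
  blockColouring p with p ≤? j | p ≤? 2 * j | p ≤? 4 * j
  ... | yes _ | _     | _     = zero
  ... | no _  | yes _ | _     = suc zero
  ... | no _  | no _  | yes _ = zero
  ... | no _  | no _  | no _  = suc zero

  colour-zero : ∀ p → blockColouring p ≡ zero → p ≤ j ⊎ (2 * j < p × p ≤ 4 * j)
  colour-zero p _ with p ≤? j | p ≤? 2 * j | p ≤? 4 * j
  colour-zero p _  | yes p≤j | _       | _        = inj₁ p≤j
  colour-zero p () | no _    | yes _   | _
  colour-zero p _  | no _    | no p≰2j | yes p≤4j = inj₂ (≰⇒> p≰2j , p≤4j)
  colour-zero p () | no _    | no _    | no _

  colour-one : ∀ p → blockColouring p ≡ suc zero → (j < p × p ≤ 2 * j) ⊎ 4 * j < p
  colour-one p _ with p ≤? j | p ≤? 2 * j | p ≤? 4 * j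
  colour-one p () | yes _   | _        | _
  colour-one p _  | no p≰j  | yes p≤2j | _        = inj₁ (≰⇒> p≰j , p≤2j)
  colour-one p () | no _    | no _     | yes _
  colour-one p _  | no _    | no _     | no p≰4j  = inj₂ (≰⇒> p≰4j)

  run-past-4j : ∀ {y} → Increasing (suc j) y → 4 * j < y 0 → 5 * j < y j
  run-past-4j {y} inc 4j<y₀ = begin-strict
    5 * j      ≡⟨ five j ⟩
    4 * j + j  <⟨ +-monoˡ-< j 4j<y₀ ⟩
    y 0 + j    ≤⟨ increasing-spread inc 0 j ≤-refl ⟩
    y j        ∎
    where
    open ≤-Reasoning
    five : ∀ j → 5 * j ≡ 4 * j + j
    five = solve-∀

  colour-one-run : ∀ {x} → MonoRun blockColouring (suc zero) (suc j) x → 4 * j < x j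
  colour-one-run {x} (inc , col) with colour-one (x j) (col j ≤-refl)
  ... | inj₂ 4j<xⱼ = 4j<xⱼ
  ... | inj₁ (_ , xⱼ≤2j) = ⊥-elim (<⇒≱ 2j<xⱼ xⱼ≤2j)
    where
    j<x₀ : j < x 0
    j<x₀ with colour-one (x 0) (col 0 (s≤s z≤n))
    ... | inj₁ (j<x₀ , _) = j<x₀
    ... | inj₂ 4j<x₀      = ≤-<-trans (m≤n*m j 4) 4j<x₀
    2j<xⱼ : 2 * j < x j
    2j<xⱼ = begin-strict
      2 * j    ≡⟨ cong (j +_) (+-identityʳ j) ⟩
      j + j    <⟨ +-monoˡ-< j j<x₀ ⟩
      x 0 + j  ≤⟨ increasing-spread inc 0 j ≤-refl ⟩
      x j      ∎
      where open ≤-Reasoning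

  from-first-block : ∀ {a b} → 1 ≤ a → a + 2 * j ≤ b → 2 * j < b × 4 * j + a < 2 * b
  from-first-block {suc a} _ le =
    ≤-trans (s≤s (m≤n+m (2 * j) a)) le , ≤-trans (≤-by a (double a j)) (*-monoʳ-≤ 2 le)
    where
    double : ∀ a j → suc (4 * j + suc a) + a ≡ 2 * (suc a + 2 * j)
    double = solve-∀

  from-third-block : ∀ {a b} → 2 * j < a → a + j ≤ b → 2 * j < b × 4 * j + a < 2 * b
  from-third-block {b = b} 2j<a le with m≤n⇒∃[o]m+o≡n 2j<a
  ... | e , refl =
    ≤-trans (s≤s (m≤m+n (2 * j) (e + j))) (subst (_≤ b) (+-assoc (suc (2 * j)) e j) le) ,
    ≤-trans (≤-by e (double e j)) (*-monoʳ-≤ 2 le)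
    where
    double : ∀ e j → suc (4 * j + (suc (2 * j) + e)) + e ≡ 2 * (suc (2 * j) + e + j)
    double = solve-∀

  colour-zero-run : ∀ {x} → MonoRun blockColouring zero (suc j) x → 1 ≤ x 0 →
                    2 * j < x j × 4 * j + x 0 < 2 * x j
  colour-zero-run {x} (inc , col) 1≤x₀ with colour-zero (x 0) (col 0 (s≤s z≤n))
  ... | inj₁ x₀≤j =
    from-first-block 1≤x₀ (+-cancelʳ-≤ (suc j) _ _ (subst (_≤ x j + suc j) (regroup (x 0) j) crossed))
    where
    skip : ∀ i → i ≤ j → suc j ≤ x i → suc (2 * j) ≤ x i
    skip i i≤j j<xᵢ with colour-zero (x i) (col i (s≤s i≤j))
    ... | inj₁ xᵢ≤j        = ⊥-elim (<⇒≱ j<xᵢ xᵢ≤j)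
    ... | inj₂ (2j<xᵢ , _) = 2j<xᵢ
    crossed : x 0 + j + suc (2 * j) ≤ x j + suc j
    crossed = increasing-jumps-gap inc skip (m≤n⇒m≤1+n x₀≤j) (+-monoˡ-≤ j 1≤x₀)
    regroup : ∀ x₀ j → x₀ + j + suc (2 * j) ≡ x₀ + 2 * j + suc j
    regroup = solve-∀
  ... | inj₂ (2j<x₀ , _) = from-third-block 2j<x₀ (increasing-spread inc 0 j ≤-refl)

  blockColouring-avoids : ∀ {N} → N ≤ 5 * j → ¬ TwoRuns blockColouring j N
  blockColouring-avoids N≤5j (twoRuns x y (suc zero) _ xRun (yInc , _) _ xⱼ<y₀ yⱼ≤N _) =
    <⇒≱ (run-past-4j yInc (<-trans (colour-one-run xRun) xⱼ<y₀)) (≤-trans yⱼ≤N N≤5j)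
  blockColouring-avoids N≤5j (twoRuns x y zero (suc zero) xRun (yInc , ycol) 1≤x₀ xⱼ<y₀ yⱼ≤N _)
    with colour-one (y 0) (ycol 0 (s≤s z≤n))
  ... | inj₁ (_ , y₀≤2j) = <⇒≱ (<-trans (proj₁ (colour-zero-run xRun 1≤x₀)) xⱼ<y₀) y₀≤2j
  ... | inj₂ 4j<y₀       = <⇒≱ (run-past-4j yInc 4j<y₀) (≤-trans yⱼ≤N N≤5j)
  blockColouring-avoids N≤5j (twoRuns x y zero zero xRun (yInc , ycol) 1≤x₀ xⱼ<y₀ _ twice)
    with colour-zero-run xRun 1≤x₀ | colour-zero (y j) (ycol j ≤-refl)
  ... | 2j<xⱼ , _ | inj₁ yⱼ≤j =
    <⇒≱ (≤-<-trans (m≤m+n j (j + 0)) (<-≤-trans (<-trans 2j<xⱼ xⱼ<y₀) (increasing-mono yInc z≤n ≤-refl))) yⱼ≤j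
  ... | _ , 4j+x₀<2xⱼ | inj₂ (_ , yⱼ≤4j) = <⇒≱ 4j+x₀<2xⱼ (≤-trans twice (+-monoˡ-≤ (x 0) yⱼ≤4j))

  ¬arrows : ∀ {N} → N ≤ 5 * j → ¬ Arrows (suc j) 2 N
  ¬arrows N≤5j arrows = blockColouring-avoids N≤5j (hasConfig-elim (arrows blockColouring))

5m∸4≡1+5[m∸1] : ∀ k → 5 * suc (suc k) ∸ 4 ≡ suc (5 * suc k)
5m∸4≡1+5[m∸1] k = cong (_∸ 4) (five k)
  where
  five : ∀ k → 5 * suc (suc k) ≡ 4 + suc (5 * suc k)
  five = solve-∀

theorem3p1 : (m : ℕ) → 2 ≤ m → IsG m 2 (5 * m ∸ 4)
theorem3p1 (suc (suc k)) _ rewrite 5m∸4≡1+5[m∸1] k =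
  s≤s z≤n , UpperBound.arrows k , least
  where
  least : ∀ N → 1 ≤ N → Arrows (suc (suc k)) 2 N → suc (5 * suc k) ≤ N
  least N _ arrows = ≮⇒≥ (λ N<1+5j → LowerBound.¬arrows (suc k) (≤-pred N<1+5j) arrows)
theorem3p1 (suc zero) (s≤s ())
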